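{- If $G$ is a connected graph and $G\in\mathfrak{T}$, then $W_\tau(G)\leq 1+(\mathrm{diam}(G)+1)\Delta(G)$, where $\mathrm{diam}(G)$ is the diameter and $\Delta(G)$ the maximum degree of $G$.
   Context: All graphs are finite, undirected, without loops or multiple edges. A total coloring of a graph $G$ is an assignment of colors to the vertices and edges of $G$ such that no two adjacent vertices, no two adjacent edges, and no vertex and an edge incident to it receive the same color. For a positive integer $t$, an interval total $t$-coloring of $G$ is a total coloring of $G$ with colors $1,2,\ldots,t$ such that each color $i\in\{1,\ldots,t\}$ is used on at least one vertex or edge, and for each vertex $v$ the set consisting of the color of $v$ and the colors of the edges incident to $v$ consists of $d_G(v)+1$ consecutive integers, where $d_G(v)$ is the degree of $v$. $\mathfrak{T}$ is the set of graphs having an interval total $t$-coloring for some $t\geq1$, and for $G\in\mathfrak{T}$, $W_\tau(G)$ is the greatest such $t$. -}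

module Defs where

open import Data.Nat using (ℕ; zero; suc; _+_; _*_; _≤_; _⊔_)
open import Data.Fin using (Fin; zero; suc)
open import Data.Bool using (Bool; true; false)
open import Data.Product using (Σ; ∃; _×_; _,_)
open import Data.Sum using (_⊎_)
open import Relation.Binary.PropositionalEquality using (_≡_; _≢_)
open import Function.Bundles using (_⇔_)

-- A finite simple graph on vertex set Fin n: symmetric, irreflexive
-- (no loops) Boolean adjacency (no multiple edges by construction).
record Graph : Set where
  field
    n      : ℕ
    adj    : Fin n → Fin n → Bool
    sym    : ∀ u v → adj u v ≡ adj v u
    irrefl : ∀ v → adj v v ≡ false
open Graph public

Vertex : Graph → Set
Vertex G = Fin (n G)

Adj : (G : Graph) → Vertex G → Vertex G → Set
Adj G u v = adj G u v ≡ true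

count : ∀ {m} → (Fin m → Bool) → ℕ
count {zero}  p = 0
count {suc m} p with p zero
... | true  = suc (count (λ i → p (suc i)))
... | false = count (λ i → p (suc i))

maxFin : ∀ {m} → (Fin m → ℕ) → ℕ
maxFin {zero}  f = 0
maxFin {suc m} f = f zero ⊔ maxFin (λ i → f (suc i))

degree : (G : Graph) → Vertex G → ℕ
degree G v = count (adj G v)

maxDegree : Graph → ℕ
maxDegree G = maxFin (degree G)

data Walk (G : Graph) : Vertex G → Vertex G → ℕ → Set where
  here : ∀ {v} → Walk G v v 0
  step : ∀ {u w v k} → Adj G u w → Walk G w v k → Walk G u v (suc k)

Connected : Graph → Set
Connected G = ∀ (u v : Vertex G) → ∃ λ k → Walk G u v k

IsDist : (G : Graph) → Vertex G → Vertex G → ℕ → Set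
IsDist G u v d = Walk G u v d × (∀ k → Walk G u v k → d ≤ k)

IsDiameter : Graph → ℕ → Set
IsDiameter G D =
  (∀ u v → ∃ λ d → IsDist G u v d × d ≤ D) × (∃ λ u → ∃ λ v → IsDist G u v D)

-- a total coloring: vertex colours f, edge colours g (g u v = colour of edge uv)
record IntervalTotalColoring (G : Graph) (t : ℕ) : Set where
  field
    f : Vertex G → ℕ
    g : Vertex G → Vertex G → ℕ
    g-sym       : ∀ u v → Adj G u v → g u v ≡ g v u
    f-range     : ∀ v → 1 ≤ f v × f v ≤ t
    g-range     : ∀ u v → Adj G u v → 1 ≤ g u v × g u v ≤ t
    vertex-prop : ∀ u v → Adj G u v → f u ≢ f v
    edge-prop   : ∀ u v w → Adj G u v → Adj G u w → v ≢ w → g u v ≢ g u w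
    incid-prop  : ∀ u v → Adj G u v → f u ≢ g u v
    surj        : ∀ i → 1 ≤ i → i ≤ t →
                  (∃ λ v → f v ≡ i) ⊎ (∃ λ u → ∃ λ v → Adj G u v × g u v ≡ i)
    interval    : ∀ v → ∃ λ a → ∀ c →
                  ((f v ≡ c ⊎ (∃ λ u → Adj G v u × g v u ≡ c))
                   ⇔ (a ≤ c × c ≤ a + degree G v))

InT : Graph → Set
InT G = ∃ λ t → 1 ≤ t × IntervalTotalColoring G t

IsWτ : Graph → ℕ → Set
IsWτ G W = (1 ≤ W × IntervalTotalColoring G W)
         × (∀ t → 1 ≤ t → IntervalTotalColoring G t → t ≤ W)

-- Let a(v) be the least colour at v, so that the colours at v are exactly
-- a(v), …, a(v) + d(v). An edge uw carries one colour that lies in both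
-- intervals, hence a(w) ≤ a(u) + Δ, and along a shortest path a(w) ≤ a(u) + diam·Δ.
-- Colour 1 is seen at some u, so a(u) ≤ 1, and colour t at some w, so
-- t ≤ a(w) + Δ; joining u to w gives t ≤ 1 + (diam + 1)·Δ.
module Submission where

open import Defs
open import Data.Nat using (ℕ; suc; _+_; _*_; _≤_)
open import Data.Nat.Properties
open import Data.Fin using (Fin; zero; suc)
open import Data.Product using (∃; _×_; _,_; proj₁; proj₂)
open import Data.Sum using (_⊎_; inj₁; inj₂)
open import Relation.Binary.PropositionalEquality using (_≡_; refl; trans; cong) renaming (sym to ≡-sym)
open import Function.Bundles using (Equivalence)

≤-maxFin : ∀ {m} (h : Fin m → ℕ) (i : Fin m) → h i ≤ maxFin h
≤-maxFin h zero    = m≤m⊔n _ _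
≤-maxFin h (suc i) = ≤-trans (≤-maxFin (λ j → h (suc j)) i) (m≤n⊔m _ _)

degree≤maxDegree : (G : Graph) (v : Vertex G) → degree G v ≤ maxDegree G
degree≤maxDegree G = ≤-maxFin (degree G)

module _ {G : Graph} {t : ℕ} (C : IntervalTotalColoring G t) where
  open IntervalTotalColoring C

  private
    Δ : ℕ
    Δ = maxDegree G

  ColourAt : Vertex G → ℕ → Set
  ColourAt v c = f v ≡ c ⊎ (∃ λ u → Adj G v u × g v u ≡ c)

  least : Vertex G → ℕ
  least v = proj₁ (interval v)

  colourAt⇒inInterval : ∀ {v c} → ColourAt v c → least v ≤ c × c ≤ least v + degree G v
  colourAt⇒inInterval {v} {c} = Equivalence.to (proj₂ (interval v) c)

  colourAt-surjective : ∀ {c} → 1 ≤ c → c ≤ t → ∃ λ v → ColourAt v c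
  colourAt-surjective 1≤c c≤t with surj _ 1≤c c≤t
  ... | inj₁ (v , fv≡c)          = v , inj₁ fv≡c
  ... | inj₂ (u , v , uv , guv≡c) = u , inj₂ (v , uv , guv≡c)

  least-adjacent : ∀ {u w} → Adj G u w → least w ≤ least u + Δ
  least-adjacent {u} {w} uw = begin
    least w                  ≤⟨ proj₁ (colourAt⇒inInterval at-w) ⟩
    g u w                    ≤⟨ proj₂ (colourAt⇒inInterval at-u) ⟩
    least u + degree G u     ≤⟨ +-monoʳ-≤ (least u) (degree≤maxDegree G u) ⟩
    least u + Δ              ∎
    where
    open ≤-Reasoning
    at-u : ColourAt u (g u w)
    at-u = inj₂ (w , uw , refl)
    at-w : ColourAt w (g u w)
    at-w = inj₂ (u , trans (Graph.sym G w u) uw , ≡-sym (g-sym u w uw))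

  least-walk : ∀ {u w k} → Walk G u w k → least w ≤ least u + k * Δ
  least-walk {u} here = ≤-reflexive (≡-sym (+-identityʳ (least u)))
  least-walk {u} {w} {suc k} (step {w = x} ux walk) = begin
    least w              ≤⟨ least-walk walk ⟩
    least x + k * Δ      ≤⟨ +-monoˡ-≤ (k * Δ) (least-adjacent ux) ⟩
    least u + Δ + k * Δ  ≡⟨ +-assoc (least u) Δ (k * Δ) ⟩
    least u + suc k * Δ  ∎
    where open ≤-Reasoning

  colours≤1+[diam+1]*Δ : 1 ≤ t → ∀ D → (∀ u w → ∃ λ k → Walk G u w k × k ≤ D) →
                         t ≤ 1 + (D + 1) * Δ
  colours≤1+[diam+1]*Δ 1≤t D short
    with colourAt-surjective ≤-refl 1≤t | colourAt-surjective 1≤t ≤-refl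
  ... | u , at-u | w , at-w with short u w
  ... | k , walk , k≤D = begin
    t                         ≤⟨ proj₂ (colourAt⇒inInterval at-w) ⟩
    least w + degree G w      ≤⟨ +-mono-≤ (least-walk walk) (degree≤maxDegree G w) ⟩
    least u + k * Δ + Δ       ≤⟨ +-monoˡ-≤ Δ (+-mono-≤ (proj₁ (colourAt⇒inInterval at-u))
                                                        (*-monoˡ-≤ Δ k≤D)) ⟩
    1 + D * Δ + Δ             ≡⟨ cong suc (+-comm (D * Δ) Δ) ⟩
    1 + suc D * Δ             ≡⟨ cong (λ d → 1 + d * Δ) (+-comm 1 D) ⟩
    1 + (D + 1) * Δ           ∎
    where open ≤-Reasoning

corollary3 : (G : Graph) → Connected G → InT G →
    ∀ D W → IsDiameter G D → IsWτ G W →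
    W ≤ 1 + (D + 1) * maxDegree G
corollary3 G _ _ D W (distances≤D , _) ((1≤W , C) , _) =
  colours≤1+[diam+1]*Δ C 1≤W D shortWalk
  where
  shortWalk : ∀ u w → ∃ λ k → Walk G u w k × k ≤ D
  shortWalk u w with distances≤D u w
  ... | d , (walk , _) , d≤D = d , walk , d≤D
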